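{- Let $t>2$ be a natural number and $n=5t$, and let $D_t=2^{4t}+2^{3t}+2^{2t}+2^t-1$ be the Dobbertin exponent. Then $D_t$ never lies in the cyclotomic coset of $e(l,k)$ modulo $2^n-1$, for any natural number $l$ and any natural number $k$ with $\gcd(k,n)\le 2$.
   Context: For natural numbers $l,k$, $e(l,k)=\sum_{j=0}^{l-1}2^{jk}$. The cyclotomic coset of $d$ modulo $2^n-1$ is $\{2^a d \bmod (2^n-1): a\ge 0\}$. -}

module Defs where

open import Data.Nat using (ℕ; zero; suc; _+_; _*_; _∸_; _^_; NonZero)
open import Data.Nat.DivMod using (_%_)
open import Data.Product using (∃-syntax)
open import Relation.Binary.PropositionalEquality using (_≡_)

e : ℕ → ℕ → ℕ
e zero    k = 0
e (suc l) k = e l k + 2 ^ (l * k)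

Dobbertin : ℕ → ℕ
Dobbertin t = (2 ^ (4 * t) + 2 ^ (3 * t) + 2 ^ (2 * t) + 2 ^ t) ∸ 1

InCoset : (n d x : ℕ) → .{{NonZero (2 ^ n ∸ 1)}} → Set
InCoset n d x = ∃[ a ] x ≡ (2 ^ a * d) % (2 ^ n ∸ 1)

-- Write M = e 5 t = D_t + 2, so that 2^(5t) - 1 = (2^t - 1) M. If D_t is congruent to
-- 2^a e(l,k) modulo 2^(5t) - 1, then 2^a e(l,k) is congruent to -2 modulo M, and multiplying by
-- 2^k - 1 (which turns the geometric sum e(l,k) into 2^(lk) - 1) gives
--   2^(a+lk) + 2^(k+1) = 2^a + 2   (mod M).
-- Modulo M a sum of two powers of 2 determines its two exponents modulo 5t: four exponents miss
-- one of the five blocks [jt, (j+1)t) of Z/5t, so a common rotation by a multiple of t (that is,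
-- multiplication by a power of 2, recalling 2^(5t) = 1 mod M) moves them all into [0, 4t), where
-- sums of two powers are below M, hence equal, and binary expansions are unique. So either
-- k + 1 = 1 (mod 5t), or a + lk = 1 and k + 1 = a (mod 5t); in the second case, going back
-- modulo 2^(5t) - 1 gives M = M 2^k, i.e. 2^k = 1 (mod 2^t - 1). Both force t | k, so
-- t <= gcd(k, 5t) <= 2.

module Submission where

open import Data.Fin using (Fin; toℕ)
open import Data.Fin.Patterns using (0F; 1F; 2F; 3F)
open import Data.Fin.Properties using (all?; any?; pigeonhole; ¬∀⟶∃¬; toℕ<n)
open import Data.List.Base using (_∷_; [])
open import Data.Nat
open import Data.Nat.DivMod hiding (_mod_)
open import Data.Nat.Divisibility
open import Data.Nat.GCD using (gcd; gcd-greatest; gcd[m,n]≢0)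
open import Data.Nat.Properties
open import Data.Nat.Tactic.RingSolver using (solve; solve-∀)
open import Data.Product
open import Data.Sum using (inj₂)
open import Function using (_∘_)
open import Level using (0ℓ)
open import Relation.Binary.Bundles using (Setoid)
open import Relation.Binary.Definitions using (Symmetric; tri<; tri≈; tri>)
open import Relation.Binary.PropositionalEquality
import Relation.Binary.Reasoning.Setoid as SetoidReasoning
open import Relation.Nullary using (¬_; yes; no; contradiction)

open import Defs

-- Congruences without subtraction

infix 4 _≡_mod_

_≡_mod_ : ℕ → ℕ → ℕ → Set
_≡_mod_ x y n = ∃₂ λ u v → x + u * n ≡ y + v * n

module _ {n : ℕ} where

  ≡⇒≡-mod : ∀ {x y} → x ≡ y → x ≡ y mod n
  ≡⇒≡-mod refl = 0 , 0 , refl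

  ≡-mod-sym : ∀ {x y} → x ≡ y mod n → y ≡ x mod n
  ≡-mod-sym (u , v , eq) = v , u , sym eq

  ≡-mod-trans : ∀ {x y z} → x ≡ y mod n → y ≡ z mod n → x ≡ z mod n
  ≡-mod-trans {x} {y} {z} (u , v , eq₁) (u′ , v′ , eq₂) = u + u′ , v′ + v , (begin
    x + (u + u′) * n       ≡⟨ solve (x ∷ u ∷ u′ ∷ n ∷ []) ⟩
    (x + u * n) + u′ * n   ≡⟨ cong (_+ u′ * n) eq₁ ⟩
    (y + v * n) + u′ * n   ≡⟨ solve (y ∷ v ∷ u′ ∷ n ∷ []) ⟩
    (y + u′ * n) + v * n   ≡⟨ cong (_+ v * n) eq₂ ⟩
    (z + v′ * n) + v * n   ≡⟨ solve (z ∷ v′ ∷ v ∷ n ∷ []) ⟩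
    z + (v′ + v) * n       ∎)
    where open ≡-Reasoning

  +-mod-cong : ∀ {x y x′ y′} → x ≡ y mod n → x′ ≡ y′ mod n → x + x′ ≡ y + y′ mod n
  +-mod-cong {x} {y} {x′} {y′} (u , v , eq) (u′ , v′ , eq′) = u + u′ , v + v′ , (begin
    (x + x′) + (u + u′) * n        ≡⟨ solve (x ∷ x′ ∷ u ∷ u′ ∷ n ∷ []) ⟩
    (x + u * n) + (x′ + u′ * n)    ≡⟨ cong₂ _+_ eq eq′ ⟩
    (y + v * n) + (y′ + v′ * n)    ≡⟨ solve (y ∷ y′ ∷ v ∷ v′ ∷ n ∷ []) ⟩
    (y + y′) + (v + v′) * n        ∎)
    where open ≡-Reasoning

  *-mod-cong : ∀ {x y x′ y′} → x ≡ y mod n → x′ ≡ y′ mod n → x * x′ ≡ y * y′ mod n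
  *-mod-cong {x} {y} {x′} {y′} (u , v , eq) (u′ , v′ , eq′) =
    u * x′ + x * u′ + u * u′ * n , v * y′ + y * v′ + v * v′ * n , (begin
    x * x′ + (u * x′ + x * u′ + u * u′ * n) * n   ≡⟨ solve (x ∷ x′ ∷ u ∷ u′ ∷ n ∷ []) ⟩
    (x + u * n) * (x′ + u′ * n)                   ≡⟨ cong₂ _*_ eq eq′ ⟩
    (y + v * n) * (y′ + v′ * n)                   ≡⟨ solve (y ∷ y′ ∷ v ∷ v′ ∷ n ∷ []) ⟩
    y * y′ + (v * y′ + y * v′ + v * v′ * n) * n   ∎)
    where open ≡-Reasoning

  *-mod-congˡ : ∀ a {x y} → x ≡ y mod n → a * x ≡ a * y mod n
  *-mod-congˡ a = *-mod-cong (≡⇒≡-mod {x = a} refl)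

  +-mod-congˡ : ∀ a {x y} → x ≡ y mod n → a + x ≡ a + y mod n
  +-mod-congˡ a = +-mod-cong (≡⇒≡-mod {x = a} refl)

  *-mod-congʳ : ∀ a {x y} → x ≡ y mod n → x * a ≡ y * a mod n
  *-mod-congʳ a x≡y = *-mod-cong x≡y (≡⇒≡-mod {x = a} refl)

  +-mod-cancelˡ : ∀ {x y} c → c + x ≡ c + y mod n → x ≡ y mod n
  +-mod-cancelˡ {x} {y} c (u , v , eq) =
    u , v , +-cancelˡ-≡ c _ _ (trans (sym (+-assoc c x _)) (trans eq (+-assoc c y _)))

  ^≡1-mod : ∀ {a} u → a ≡ 1 mod n → a ^ u ≡ 1 mod n
  ^≡1-mod zero    a≡1 = ≡⇒≡-mod refl
  ^≡1-mod (suc u) a≡1 = *-mod-cong a≡1 (^≡1-mod u a≡1)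

  m≡m%n-mod : ∀ x .{{_ : NonZero n}} → x ≡ x % n mod n
  m≡m%n-mod x = 0 , x / n , trans (+-identityʳ x) (m≡m%n+[m/n]*n x n)

  n≡0-mod : n ≡ 0 mod n
  n≡0-mod = 0 , 1 , refl

  ≡-mod⇒%≡ : ∀ {x y} .{{_ : NonZero n}} → x ≡ y mod n → x % n ≡ y % n
  ≡-mod⇒%≡ {x} {y} (u , v , eq) = begin
    x % n             ≡⟨ [m+kn]%n≡m%n x u n ⟨
    (x + u * n) % n   ≡⟨ cong (_% n) eq ⟩
    (y + v * n) % n   ≡⟨ [m+kn]%n≡m%n y v n ⟩
    y % n             ∎
    where open ≡-Reasoning

  %≡⇒≡-mod : ∀ {x y} .{{_ : NonZero n}} → x % n ≡ y % n → x ≡ y mod n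
  %≡⇒≡-mod {x} {y} eq =
    ≡-mod-trans (m≡m%n-mod x) (≡-mod-trans (≡⇒≡-mod eq) (≡-mod-sym (m≡m%n-mod y)))

  ≡-mod⇒≡ : ∀ {x y} → x ≡ y mod n → x < n → y < n → x ≡ y
  ≡-mod⇒≡ {x} {y} x≡y x<n y<n = begin
    x       ≡⟨ m<n⇒m%n≡m x<n ⟨
    x % n   ≡⟨ ≡-mod⇒%≡ x≡y ⟩
    y % n   ≡⟨ m<n⇒m%n≡m y<n ⟩
    y       ∎
    where
    open ≡-Reasoning
    instance
      n≢0 : NonZero n
      n≢0 = >-nonZero (≤-trans (s≤s z≤n) x<n)

≡0-mod⇒∣ : ∀ {n x} .{{_ : NonZero n}} → x ≡ 0 mod n → n ∣ x
≡0-mod⇒∣ {n@(suc _)} {x} x≡0 = m%n≡0⇒n∣m x n (≡-mod⇒%≡ x≡0)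

m≡1-mod[m∸1] : ∀ {m} → 1 ≤ m → m ≡ 1 mod (m ∸ 1)
m≡1-mod[m∸1] {m} 1≤m = 0 , 1 , (begin
  m + 0               ≡⟨ +-identityʳ m ⟩
  m                   ≡⟨ m+[n∸m]≡n 1≤m ⟨
  1 + (m ∸ 1)         ≡⟨ cong suc (+-identityʳ (m ∸ 1)) ⟨
  1 + 1 * (m ∸ 1)     ∎)
  where open ≡-Reasoning

≡-mod-setoid : ℕ → Setoid 0ℓ 0ℓ
≡-mod-setoid n = record
  { Carrier       = ℕ
  ; _≈_           = _≡_mod n
  ; isEquivalence = record { refl = ≡⇒≡-mod refl ; sym = ≡-mod-sym ; trans = ≡-mod-trans }
  }

module ≡-mod-Reasoning (n : ℕ) = SetoidReasoning (≡-mod-setoid n)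

≡-mod-∣ : ∀ {d n x y} → d ∣ n → x ≡ y mod n → x ≡ y mod d
≡-mod-∣ {d} {x = x} {y} (divides q refl) (u , v , eq) = u * q , v * q , (begin
  x + u * q * d     ≡⟨ cong (x +_) (*-assoc u q d) ⟩
  x + u * (q * d)   ≡⟨ eq ⟩
  y + v * (q * d)   ≡⟨ cong (y +_) (*-assoc v q d) ⟨
  y + v * q * d     ∎)
  where open ≡-Reasoning

*-mod-cancelˡ : ∀ {a n x y} .{{_ : NonZero a}} → a * x ≡ a * y mod a * n → x ≡ y mod n
*-mod-cancelˡ {a} {n} {x} {y} (u , v , eq) = u , v , *-cancelˡ-≡ _ _ a (begin
  a * (x + u * n)         ≡⟨ solve (a ∷ x ∷ u ∷ n ∷ []) ⟩
  a * x + u * (a * n)     ≡⟨ eq ⟩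
  a * y + v * (a * n)     ≡⟨ solve (a ∷ y ∷ v ∷ n ∷ []) ⟩
  a * (y + v * n)         ∎)
  where open ≡-Reasoning

m^n*[m^p]^q≡m^[n+q*p] : ∀ m n p q → m ^ n * (m ^ p) ^ q ≡ m ^ (n + q * p)
m^n*[m^p]^q≡m^[n+q*p] m n p q = begin
  m ^ n * (m ^ p) ^ q   ≡⟨ cong (m ^ n *_) (^-*-assoc m p q) ⟩
  m ^ n * m ^ (p * q)   ≡⟨ ^-distribˡ-+-* m n (p * q) ⟨
  m ^ (n + p * q)       ≡⟨ cong (λ e → m ^ (n + e)) (*-comm p q) ⟩
  m ^ (n + q * p)       ∎
  where open ≡-Reasoning

^-mod-congʳ : ∀ {b p n x y} → b ^ p ≡ 1 mod n → x ≡ y mod p → b ^ x ≡ b ^ y mod n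
^-mod-congʳ {b} {p} {n} {x} {y} bᵖ≡1 (u , v , eq) = begin
  b ^ x                 ≡⟨ *-identityʳ (b ^ x) ⟨
  b ^ x * 1             ≈⟨ *-mod-congˡ (b ^ x) (^≡1-mod u bᵖ≡1) ⟨
  b ^ x * (b ^ p) ^ u   ≡⟨ m^n*[m^p]^q≡m^[n+q*p] b x p u ⟩
  b ^ (x + u * p)       ≡⟨ cong (b ^_) eq ⟩
  b ^ (y + v * p)       ≡⟨ m^n*[m^p]^q≡m^[n+q*p] b y p v ⟨
  b ^ y * (b ^ p) ^ v   ≈⟨ *-mod-congˡ (b ^ y) (^≡1-mod v bᵖ≡1) ⟩
  b ^ y * 1             ≡⟨ *-identityʳ (b ^ y) ⟩
  b ^ y                 ∎
  where
  open ≡-mod-Reasoning n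

data SamePair (R : ℕ → ℕ → Set) (p q r s : ℕ) : Set where
  straight : R p r → R q s → SamePair R p q r s
  crossed  : R p s → R q r → SamePair R p q r s

module _ {R : ℕ → ℕ → Set} {p q r s : ℕ} where

  SamePair-map : ∀ {S : ℕ → ℕ → Set} (f : ℕ → ℕ) → (∀ {x y} → S (f x) (f y) → R x y) →
                 SamePair S (f p) (f q) (f r) (f s) → SamePair R p q r s
  SamePair-map f back (straight pr qs) = straight (back pr) (back qs)
  SamePair-map f back (crossed ps qr)  = crossed (back ps) (back qr)

  SamePair-swapˡ : SamePair R p q r s → SamePair R q p r s
  SamePair-swapˡ (straight pr qs) = crossed qs pr
  SamePair-swapˡ (crossed ps qr)  = straight qr ps

  SamePair-sym : Symmetric R → SamePair R p q r s → SamePair R r s p q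
  SamePair-sym R-sym (straight pr qs) = straight (R-sym pr) (R-sym qs)
  SamePair-sym R-sym (crossed ps qr)  = crossed (R-sym qr) (R-sym ps)

2^-injective : ∀ {x y} → 2 ^ x ≡ 2 ^ y → x ≡ y
2^-injective {x} {y} eq with <-cmp x y
... | tri< x<y _ _ = contradiction eq (<⇒≢ (^-monoʳ-< 2 (s≤s (s≤s z≤n)) x<y))
... | tri≈ _ x≡y _ = x≡y
... | tri> _ _ y<x = contradiction eq (>⇒≢ (^-monoʳ-< 2 (s≤s (s≤s z≤n)) y<x))

1+2^q-injective : ∀ q r s → 1 + 2 ^ q ≡ 2 ^ r + 2 ^ s → SamePair _≡_ 0 q r s
1+2^q-injective zero    zero    zero    eq = straight refl refl
1+2^q-injective zero    zero    (suc s) eq = contradiction (sym (+-cancelˡ-≡ 1 _ _ eq)) (even≢odd (2 ^ s) 0)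
1+2^q-injective zero    (suc r) zero    eq = contradiction (sym (+-cancelʳ-≡ 1 _ _ eq)) (even≢odd (2 ^ r) 0)
1+2^q-injective zero    (suc r) (suc s) eq =
  contradiction eq (<⇒≢ (+-mono-≤ (^-monoʳ-≤ 2 (s≤s (z≤n {r}))) (m^n>0 2 (suc s))))
1+2^q-injective (suc q) zero    zero    eq = contradiction (+-cancelˡ-≡ 1 _ _ eq) (even≢odd (2 ^ q) 0)
1+2^q-injective (suc q) zero    (suc s) eq = straight refl (2^-injective (+-cancelˡ-≡ 1 _ _ eq))
1+2^q-injective (suc q) (suc r) zero    eq = crossed refl (2^-injective (+-cancelˡ-≡ 1 _ _ (trans eq (+-comm _ 1))))
1+2^q-injective (suc q) (suc r) (suc s) eq =
  contradiction (trans (*-distribˡ-+ 2 (2 ^ r) (2 ^ s)) (sym eq)) (even≢odd (2 ^ r + 2 ^ s) (2 ^ q))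

2^+2^-injective : ∀ p q r s → 2 ^ p + 2 ^ q ≡ 2 ^ r + 2 ^ s → SamePair _≡_ p q r s
2^+2^-injective zero    q       r       s       eq = 1+2^q-injective q r s eq
2^+2^-injective (suc p) zero    r       s       eq =
  SamePair-swapˡ (1+2^q-injective (suc p) r s (trans (+-comm 1 _) eq))
2^+2^-injective (suc p) (suc q) zero    s       eq =
  SamePair-sym sym (1+2^q-injective s (suc p) (suc q) (sym eq))
2^+2^-injective (suc p) (suc q) (suc r) zero    eq =
  SamePair-sym sym (SamePair-swapˡ (1+2^q-injective (suc r) (suc p) (suc q) (trans (+-comm 1 _) (sym eq))))
2^+2^-injective (suc p) (suc q) (suc r) (suc s) eq with 2^+2^-injective p q r s halved
  where
  halved : 2 ^ p + 2 ^ q ≡ 2 ^ r + 2 ^ s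
  halved = *-cancelˡ-≡ _ _ 2 (begin
    2 * (2 ^ p + 2 ^ q)     ≡⟨ *-distribˡ-+ 2 (2 ^ p) (2 ^ q) ⟩
    2 ^ suc p + 2 ^ suc q   ≡⟨ eq ⟩
    2 ^ suc r + 2 ^ suc s   ≡⟨ *-distribˡ-+ 2 (2 ^ r) (2 ^ s) ⟨
    2 * (2 ^ r + 2 ^ s)     ∎)
    where open ≡-Reasoning
... | straight pr qs = straight (cong suc pr) (cong suc qs)
... | crossed ps qr  = crossed (cong suc ps) (cong suc qr)

2^x+2^y≤2^n : ∀ {x y n} → x < n → y < n → 2 ^ x + 2 ^ y ≤ 2 ^ n
2^x+2^y≤2^n {x} {y} {suc n} (s≤s x≤n) (s≤s y≤n) = begin
  2 ^ x + 2 ^ y     ≤⟨ +-mono-≤ (^-monoʳ-≤ 2 x≤n) (^-monoʳ-≤ 2 y≤n) ⟩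
  2 ^ n + 2 ^ n     ≡⟨ cong (2 ^ n +_) (+-identityʳ (2 ^ n)) ⟨
  2 ^ suc n         ∎
  where open ≤-Reasoning

1+[2^k∸1]≡2^k : ∀ k → suc (2 ^ k ∸ 1) ≡ 2 ^ k
1+[2^k∸1]≡2^k k = m+[n∸m]≡n (m^n>0 2 k)

e[l,k]*[2^k∸1]+1≡2^[l*k] : ∀ l k → e l k * (2 ^ k ∸ 1) + 1 ≡ 2 ^ (l * k)
e[l,k]*[2^k∸1]+1≡2^[l*k] zero    k = refl
e[l,k]*[2^k∸1]+1≡2^[l*k] (suc l) k = begin
  (e l k + 2 ^ (l * k)) * w + 1         ≡⟨ distrib E P w ⟩
  (E * w + 1) + P * w                   ≡⟨ cong (_+ P * w) (e[l,k]*[2^k∸1]+1≡2^[l*k] l k) ⟩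
  P + P * w                             ≡⟨ *-suc P w ⟨
  P * suc w                             ≡⟨ cong (P *_) (1+[2^k∸1]≡2^k k) ⟩
  P * 2 ^ k                             ≡⟨ *-comm P (2 ^ k) ⟩
  2 ^ k * P                             ≡⟨ ^-distribˡ-+-* 2 k (l * k) ⟨
  2 ^ (k + l * k)                       ∎
  where
  open ≡-Reasoning
  E P w : ℕ
  E = e l k
  P = 2 ^ (l * k)
  w = 2 ^ k ∸ 1
  distrib : ∀ E P w → (E + P) * w + 1 ≡ (E * w + 1) + P * w
  distrib = solve-∀

2^[d*t]≡1-mod-e : ∀ d t → 2 ^ (d * t) ≡ 1 mod e d t
2^[d*t]≡1-mod-e d t = 0 , 2 ^ t ∸ 1 , (begin
  2 ^ (d * t) + 0               ≡⟨ +-identityʳ _ ⟩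
  2 ^ (d * t)                   ≡⟨ e[l,k]*[2^k∸1]+1≡2^[l*k] d t ⟨
  e d t * (2 ^ t ∸ 1) + 1       ≡⟨ +-comm _ 1 ⟩
  1 + e d t * (2 ^ t ∸ 1)       ≡⟨ cong (1 +_) (*-comm (e d t) _) ⟩
  1 + (2 ^ t ∸ 1) * e d t       ∎)
  where open ≡-Reasoning

2^a*e[l,k]*[2^k∸1]+2^a≡2^[a+l*k] : ∀ a l k → 2 ^ a * e l k * (2 ^ k ∸ 1) + 2 ^ a ≡ 2 ^ (a + l * k)
2^a*e[l,k]*[2^k∸1]+2^a≡2^[a+l*k] a l k = begin
  2 ^ a * e l k * (2 ^ k ∸ 1) + 2 ^ a     ≡⟨ factor (2 ^ a) (e l k) (2 ^ k ∸ 1) ⟩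
  2 ^ a * (e l k * (2 ^ k ∸ 1) + 1)       ≡⟨ cong (2 ^ a *_) (e[l,k]*[2^k∸1]+1≡2^[l*k] l k) ⟩
  2 ^ a * 2 ^ (l * k)                     ≡⟨ ^-distribˡ-+-* 2 a (l * k) ⟨
  2 ^ (a + l * k)                         ∎
  where
  open ≡-Reasoning
  factor : ∀ A E w → A * E * w + A ≡ A * (E * w + 1)
  factor = solve-∀

0<e[1+l,k] : ∀ l k → 0 < e (suc l) k
0<e[1+l,k] l k = <-≤-trans (m^n>0 2 (l * k)) (m≤n+m _ (e l k))

2^x+2^y<e[1+g,t] : ∀ {g t x y} → x < g * t → y < g * t → 2 ^ x + 2 ^ y < e (suc g) t
2^x+2^y<e[1+g,t] {zero}  ()
2^x+2^y<e[1+g,t] {suc g} {t} {x} {y} x<gt y<gt = begin-strict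
  2 ^ x + 2 ^ y                       ≤⟨ 2^x+2^y≤2^n x<gt y<gt ⟩
  2 ^ (suc g * t)                     <⟨ m<n+m _ (0<e[1+l,k] g t) ⟩
  e (suc g) t + 2 ^ (suc g * t)       ∎
  where open ≤-Reasoning

2^j<2^t∸1 : ∀ {j t} → 1 < t → j < t → 2 ^ j < 2 ^ t ∸ 1
2^j<2^t∸1 1<t j<t = ∸-monoˡ-≤ 1 (2^x+2^y≤2^n 1<t j<t)

2^k≡1-mod[2^t∸1]⇒t∣k : ∀ {t k} → 1 < t → 2 ^ k ≡ 1 mod (2 ^ t ∸ 1) → t ∣ k
2^k≡1-mod[2^t∸1]⇒t∣k {t} {k} 1<t 2^k≡1 = m%n≡0⇒n∣m k t (sym (2^-injective {0} 1≡2^[k%t]))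
  where
  instance
    t≢0 : NonZero t
    t≢0 = >-nonZero (<-trans z<s 1<t)
  1≡2^[k%t] : 1 ≡ 2 ^ (k % t)
  1≡2^[k%t] = ≡-mod⇒≡
    (≡-mod-trans (≡-mod-sym 2^k≡1) (^-mod-congʳ (m≡1-mod[m∸1] (m^n>0 2 t)) (m≡m%n-mod k)))
    (2^j<2^t∸1 1<t (<-trans z<s 1<t)) (2^j<2^t∸1 1<t (m%n<n k t))

∣⇒≤gcd : ∀ {d m n} .{{_ : NonZero n}} → d ∣ m → d ∣ n → d ≤ gcd m n
∣⇒≤gcd {m = m} {n} d∣m d∣n =
  ∣⇒≤ {{≢-nonZero (gcd[m,n]≢0 m n (inj₂ (≢-nonZero⁻¹ n)))}} (gcd-greatest d∣m d∣n)

a*t+r<d*t : ∀ {a d r t} → a < d → r < t → a * t + r < d * t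
a*t+r<d*t {a} {d} {r} {t} a<d r<t = begin-strict
  a * t + r     <⟨ +-monoʳ-< (a * t) r<t ⟩
  a * t + t     ≡⟨ +-comm (a * t) t ⟩
  suc a * t     ≤⟨ *-monoˡ-≤ t a<d ⟩
  d * t         ∎
  where open ≤-Reasoning

[g∸v+b]%[1+g]<g : ∀ {g v} b → v ≤ g → b % suc g ≢ v → (g ∸ v + b) % suc g < g
[g∸v+b]%[1+g]<g {g} {v} b v≤g b≢v = ≤∧≢⇒< (s≤s⁻¹ (m%n<n (g ∸ v + b) (suc g))) hits-g
  where
  g%[1+g]≡g : (g ∸ v + v) % suc g ≡ g
  g%[1+g]≡g = trans (cong (_% suc g) (m∸n+n≡m v≤g)) (m<n⇒m%n≡m (n<1+n g))
  hits-g : (g ∸ v + b) % suc g ≢ g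
  hits-g eq = b≢v (trans (≡-mod⇒%≡ b≡v) (m<n⇒m%n≡m (s≤s v≤g)))
    where
    b≡v : b ≡ v mod suc g
    b≡v = +-mod-cancelˡ (g ∸ v) (%≡⇒≡-mod (trans eq (sym g%[1+g]≡g)))

∃-missed-value : ∀ {m d} → m < d → (b : Fin m → ℕ) → ∃[ v ] v < d × ∀ i → b i ≢ v
∃-missed-value {m} {d} m<d b with all? (λ (j : Fin d) → any? (λ i → b i ≟ toℕ j))
... | yes hit = contradiction (pigeonhole m<d (proj₁ ∘ hit)) λ (j , j′ , j<j′ , same) →
  <⇒≢ j<j′ (trans (sym (proj₂ (hit j))) (trans (cong b same) (proj₂ (hit j′))))
... | no ¬hit with ¬∀⟶∃¬ d _ (λ j → any? (λ i → b i ≟ toℕ j)) ¬hit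
...   | j , missed = toℕ j , toℕ<n j , λ i eq → missed (i , eq)

-- `suc g * t` normalises to `t + g * t`, hence the shape of the instance below; it lives in its
-- own module because outside it instance search for `NonZero t` on a variable `t` loops on it.
module Rotation where

  private instance
    m+n-nonZero : ∀ {m n} .{{_ : NonZero m}} → NonZero (m + n)
    m+n-nonZero {suc m} = _

  [c*t+x]%[[1+g]*t]≡[c+x/t]%[1+g]*t+x%t : ∀ g t c x .{{_ : NonZero t}} →
    (c * t + x) % (suc g * t) ≡ (c + x / t) % suc g * t + x % t
  [c*t+x]%[[1+g]*t]≡[c+x/t]%[1+g]*t+x%t g t c x = begin
    (c * t + x) % (d * t)                              ≡⟨ cong (_% (d * t)) decompose ⟩
    (B % d * t + x % t + B / d * (d * t)) % (d * t)    ≡⟨ [m+kn]%n≡m%n _ (B / d) (d * t) ⟩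
    (B % d * t + x % t) % (d * t)                      ≡⟨ m<n⇒m%n≡m below ⟩
    B % d * t + x % t                                  ∎
    where
    open ≡-Reasoning
    d B : ℕ
    d = suc g
    B = c + x / t
    decompose : c * t + x ≡ B % d * t + x % t + B / d * (d * t)
    decompose = begin
      c * t + x                                  ≡⟨ cong (c * t +_) (m≡m%n+[m/n]*n x t) ⟩
      c * t + (x % t + x / t * t)                ≡⟨ gather c (x / t) (x % t) t ⟩
      B * t + x % t                              ≡⟨ cong (λ b → b * t + x % t) (m≡m%n+[m/n]*n B d) ⟩
      (B % d + B / d * d) * t + x % t            ≡⟨ spread (B % d) (B / d) d t (x % t) ⟩
      B % d * t + x % t + B / d * (d * t)        ∎
      where
      gather : ∀ c q r t → c * t + (r + q * t) ≡ (c + q) * t + r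
      gather = solve-∀
      spread : ∀ R Q d t r → (R + Q * d) * t + r ≡ R * t + r + Q * (d * t)
      spread = solve-∀
    below : B % d * t + x % t < d * t
    below = a*t+r<d*t (m%n<n B d) (m%n<n x t)

  rotate-below : ∀ g t .{{_ : NonZero t}} {v} x → v ≤ g → x / t % suc g ≢ v →
                 ((g ∸ v) * t + x) % (suc g * t) < g * t
  rotate-below g t {v} x v≤g block≢v = begin-strict
    ((g ∸ v) * t + x) % (suc g * t)           ≡⟨ [c*t+x]%[[1+g]*t]≡[c+x/t]%[1+g]*t+x%t g t (g ∸ v) x ⟩
    (g ∸ v + x / t) % suc g * t + x % t       <⟨ a*t+r<d*t {d = g} rotated-block-below (m%n<n x t) ⟩
    g * t                                     ∎
    where
    open ≤-Reasoning
    rotated-block-below : (g ∸ v + x / t) % suc g < g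
    rotated-block-below = [g∸v+b]%[1+g]<g (x / t) v≤g block≢v

  ∃-rotation-below : ∀ g t .{{_ : NonZero t}} {m} → m ≤ g → (xs : Fin m → ℕ) →
           ∃[ c ] ∀ i → (c * t + xs i) % (suc g * t) < g * t
  ∃-rotation-below g t m≤g xs =
    let v , v<1+g , free = ∃-missed-value (s≤s m≤g) (λ i → xs i / t % suc g)
    in  g ∸ v , λ i → rotate-below g t (xs i) (s≤s⁻¹ v<1+g) (free i)

  2^+2^-injective-mod-e : ∀ g t .{{_ : NonZero t}} → 4 ≤ g → ∀ {p q r s} →
    2 ^ p + 2 ^ q ≡ 2 ^ r + 2 ^ s mod e (suc g) t → SamePair (_≡_mod (suc g * t)) p q r s
  2^+2^-injective-mod-e g t 4≤g {p} {q} {r} {s} eq =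
    SamePair-map ρ unrotate (2^+2^-injective (ρ p) (ρ q) (ρ r) (ρ s)
      (≡-mod⇒≡ rotated (below 0F 1F) (below 2F 3F)))
    where
    exponents : Fin 4 → ℕ
    exponents 0F = p
    exponents 1F = q
    exponents 2F = r
    exponents 3F = s
    shift : ∃[ c ] ∀ i → (c * t + exponents i) % (suc g * t) < g * t
    shift = ∃-rotation-below g t 4≤g exponents
    c : ℕ
    c = proj₁ shift
    ρ : ℕ → ℕ
    ρ x = (c * t + x) % (suc g * t)
    below : ∀ i j → 2 ^ ρ (exponents i) + 2 ^ ρ (exponents j) < e (suc g) t
    below i j = 2^x+2^y<e[1+g,t] {g} {t} (proj₂ shift i) (proj₂ shift j)
    rotate : ∀ x → 2 ^ (c * t) * 2 ^ x ≡ 2 ^ ρ x mod e (suc g) t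
    rotate x = ≡-mod-trans (≡⇒≡-mod (sym (^-distribˡ-+-* 2 (c * t) x)))
      (^-mod-congʳ (2^[d*t]≡1-mod-e (suc g) t) (m≡m%n-mod {suc g * t} (c * t + x)))
    rotated : 2 ^ ρ p + 2 ^ ρ q ≡ 2 ^ ρ r + 2 ^ ρ s mod e (suc g) t
    rotated = begin
      2 ^ ρ p + 2 ^ ρ q                          ≈⟨ +-mod-cong (rotate p) (rotate q) ⟨
      2 ^ (c * t) * 2 ^ p + 2 ^ (c * t) * 2 ^ q  ≡⟨ *-distribˡ-+ (2 ^ (c * t)) (2 ^ p) (2 ^ q) ⟨
      2 ^ (c * t) * (2 ^ p + 2 ^ q)              ≈⟨ *-mod-congˡ (2 ^ (c * t)) eq ⟩
      2 ^ (c * t) * (2 ^ r + 2 ^ s)              ≡⟨ *-distribˡ-+ (2 ^ (c * t)) (2 ^ r) (2 ^ s) ⟩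
      2 ^ (c * t) * 2 ^ r + 2 ^ (c * t) * 2 ^ s  ≈⟨ +-mod-cong (rotate r) (rotate s) ⟩
      2 ^ ρ r + 2 ^ ρ s                          ∎
      where open ≡-mod-Reasoning (e (suc g) t)
    unrotate : ∀ {x y} → ρ x ≡ ρ y → x ≡ y mod suc g * t
    unrotate ρx≡ρy = +-mod-cancelˡ (c * t) (%≡⇒≡-mod ρx≡ρy)

open Rotation public

Dobbertin+2≡e[5,t] : ∀ t → Dobbertin t + 2 ≡ e 5 t
Dobbertin+2≡e[5,t] t = begin
  (S ∸ 1) + 2
    ≡⟨ +-suc (S ∸ 1) 1 ⟩
  suc ((S ∸ 1) + 1)
    ≡⟨ cong suc (m∸n+n≡m (≤-trans (m^n>0 2 t) (m≤n+m (2 ^ t) _))) ⟩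
  suc S
    ≡⟨ reverse (2 ^ t) (2 ^ (2 * t)) (2 ^ (3 * t)) (2 ^ (4 * t)) ⟩
  1 + 2 ^ t + 2 ^ (2 * t) + 2 ^ (3 * t) + 2 ^ (4 * t)
    ≡⟨ cong (λ j → 1 + 2 ^ j + 2 ^ (2 * t) + 2 ^ (3 * t) + 2 ^ (4 * t)) (*-identityˡ t) ⟨
  e 5 t
    ∎
  where
  open ≡-Reasoning
  S : ℕ
  S = 2 ^ (4 * t) + 2 ^ (3 * t) + 2 ^ (2 * t) + 2 ^ t
  reverse : ∀ a b c d → suc (d + c + b + a) ≡ 1 + a + b + c + d
  reverse = solve-∀

2^[5t]∸1≡e[5,t]*[2^t∸1] : ∀ t → 2 ^ (5 * t) ∸ 1 ≡ e 5 t * (2 ^ t ∸ 1)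
2^[5t]∸1≡e[5,t]*[2^t∸1] t =
  trans (cong (_∸ 1) (sym (e[l,k]*[2^k∸1]+1≡2^[l*k] 5 t))) (m+n∸n≡m _ 1)

module _ {t : ℕ} (1<t : 1 < t) (a l k : ℕ)
         (X≡D : 2 ^ a * e l k ≡ Dobbertin t mod e 5 t * (2 ^ t ∸ 1)) where

  private
    X D w : ℕ
    X = 2 ^ a * e l k
    D = Dobbertin t
    w = 2 ^ k ∸ 1
    instance
      t≢0 : NonZero t
      t≢0 = >-nonZero (<-trans z<s 1<t)

  coset⇒2^[a+l*k]+2^[1+k]≡2^a+2^1 : 2 ^ (a + l * k) + 2 ^ suc k ≡ 2 ^ a + 2 ^ 1 mod e 5 t
  coset⇒2^[a+l*k]+2^[1+k]≡2^a+2^1 = begin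
    2 ^ (a + l * k) + 2 ^ suc k     ≡⟨ cong₂ _+_ (sym (2^a*e[l,k]*[2^k∸1]+2^a≡2^[a+l*k] a l k))
                                                   (cong (2 *_) (sym (1+[2^k∸1]≡2^k k))) ⟩
    (X * w + 2 ^ a) + 2 * suc w     ≡⟨ regroup X w (2 ^ a) ⟩
    (X + 2) * w + (2 ^ a + 2)       ≈⟨ +-mod-cong (*-mod-congʳ w X+2≡0) (≡⇒≡-mod refl) ⟩
    2 ^ a + 2 ^ 1                   ∎
    where
    open ≡-mod-Reasoning (e 5 t)
    regroup : ∀ X w A → (X * w + A) + 2 * suc w ≡ (X + 2) * w + (A + 2)
    regroup = solve-∀
    X+2≡0 : X + 2 ≡ 0 mod e 5 t
    X+2≡0 = begin
      X + 2        ≈⟨ +-mod-cong (≡-mod-∣ (m∣m*n (2 ^ t ∸ 1)) X≡D) (≡⇒≡-mod refl) ⟩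
      D + 2        ≡⟨ Dobbertin+2≡e[5,t] t ⟩
      e 5 t        ≈⟨ n≡0-mod ⟩
      0            ∎

  coset-crossed⇒2^k≡1 : a + l * k ≡ 1 mod 5 * t → suc k ≡ a mod 5 * t → 2 ^ k ≡ 1 mod (2 ^ t ∸ 1)
  coset-crossed⇒2^k≡1 a+lk≡1 1+k≡a = ≡-mod-sym (*-mod-cancelˡ {e 5 t} {{e5≢0}} (begin
    e 5 t * 1                        ≡⟨ *-identityʳ (e 5 t) ⟩
    e 5 t                            ≡⟨ Dobbertin+2≡e[5,t] t ⟨
    D + 2                            ≈⟨ +-mod-congˡ D (^-mod-congʳ 2^[5t]≡1 a+lk≡1) ⟨
    D + 2 ^ (a + l * k)              ≡⟨ cong (D +_) (2^a*e[l,k]*[2^k∸1]+2^a≡2^[a+l*k] a l k) ⟨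
    D + (X * w + 2 ^ a)              ≈⟨ +-mod-congˡ D (+-mod-cong (*-mod-congʳ w X≡D)
                                                                 (^-mod-congʳ 2^[5t]≡1 (≡-mod-sym 1+k≡a))) ⟩
    D + (D * w + 2 ^ suc k)          ≡⟨ cong (λ x → D + (D * w + 2 * x)) (1+[2^k∸1]≡2^k k) ⟨
    D + (D * w + 2 * suc w)          ≡⟨ regroup D w ⟩
    (D + 2) * suc w                  ≡⟨ cong₂ _*_ (Dobbertin+2≡e[5,t] t) (1+[2^k∸1]≡2^k k) ⟩
    e 5 t * 2 ^ k                    ∎))
    where
    open ≡-mod-Reasoning (e 5 t * (2 ^ t ∸ 1))
    e5≢0 : NonZero (e 5 t)
    e5≢0 = >-nonZero (0<e[1+l,k] 4 t)
    2^[5t]≡1 : 2 ^ (5 * t) ≡ 1 mod e 5 t * (2 ^ t ∸ 1)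
    2^[5t]≡1 = subst (2 ^ (5 * t) ≡ 1 mod_) (2^[5t]∸1≡e[5,t]*[2^t∸1] t) (m≡1-mod[m∸1] (m^n>0 2 (5 * t)))
    regroup : ∀ D w → D + (D * w + 2 * suc w) ≡ (D + 2) * suc w
    regroup = solve-∀

  coset⇒t∣k : t ∣ k
  coset⇒t∣k = cases (2^+2^-injective-mod-e 4 t ≤-refl coset⇒2^[a+l*k]+2^[1+k]≡2^a+2^1)
    where
    cases : SamePair (_≡_mod 5 * t) (a + l * k) (suc k) a 1 → t ∣ k
    cases (straight _ 1+k≡1)      = ≡0-mod⇒∣ (≡-mod-∣ (n∣m*n 5) (+-mod-cancelˡ 1 1+k≡1))
    cases (crossed a+lk≡1 1+k≡a) = 2^k≡1-mod[2^t∸1]⇒t∣k 1<t (coset-crossed⇒2^k≡1 a+lk≡1 1+k≡a)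

theorem10 : (t : ℕ) → 2 < t → .{{_ : NonZero (2 ^ (5 * t) ∸ 1)}} →
    (l k : ℕ) → gcd k (5 * t) ≤ 2 →
    ¬ InCoset (5 * t) (e l k) (Dobbertin t)
theorem10 t 2<t l k gcd≤2 (a , D≡X%m) = <⇒≱ 2<t (≤-trans t≤gcd gcd≤2)
  where
  1<t : 1 < t
  1<t = <-trans (n<1+n 1) 2<t
  instance
    t≢0 : NonZero t
    t≢0 = >-nonZero (<-trans z<s 1<t)
    5t≢0 : NonZero (5 * t)
    5t≢0 = m*n≢0 5 t
  X≡D : 2 ^ a * e l k ≡ Dobbertin t mod e 5 t * (2 ^ t ∸ 1)
  X≡D = subst (2 ^ a * e l k ≡ Dobbertin t mod_) (2^[5t]∸1≡e[5,t]*[2^t∸1] t)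
    (≡-mod-trans (m≡m%n-mod (2 ^ a * e l k)) (≡⇒≡-mod (sym D≡X%m)))
  t≤gcd : t ≤ gcd k (5 * t)
  t≤gcd = ∣⇒≤gcd (coset⇒t∣k 1<t a l k X≡D) (n∣m*n 5)
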